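{- Let $\mathbf{b}=(b_i)_{i\ge0}$ be a sequence of nonzero elements of a field and $\mathbf{a}=(a_i)_{i\ge1}$ a sequence in that field. Define $\mathbf{b}'=(b_i^{ -1})_{i\ge0}$ and $\mathbf{a}'=(a_ib_{i-1}^{ -1}b_i^{ -1})_{i\ge1}$. Then for all positive integers $n$ and $k$, \[ \sigma^{\le k}_{ -n}(\mathbf{b},\mathbf{a})=b_0^{ -1}\sum_{\pi\in\mathrm{Sch}^{\le k}_{2n-2}}\mathrm{wt}(\pi;\mathbf{b}',\mathbf{a}')=b_0^{ -1}\sigma^{\le k}_{n-1}(\mathbf{b}',\mathbf{a}'). \]
   Context: A Schröder path is a finite sequence of points of $\mathbb{Z}\times\mathbb{Z}_{\ge0}$ whose steps are each $(1,1)$ (up), $(2,0)$ (double-horizontal) or $(1,-1)$ (down). For sequences $\mathbf{b}=(b_i)_{i\ge0}$, $\mathbf{a}=(a_i)_{i\ge1}$, the weight $\mathrm{wt}(\pi;\mathbf{b},\mathbf{a})$ is the product of $b_i$ over double-horizontal steps starting at height $i$ and of $a_i$ over down steps starting at height $i$. $\mathrm{Sch}^{\le k}_{N}$ is the set of Schröder paths from $(0,0)$ to $(N,0)$ staying weakly below $y=k$, and $\sigma^{\le k}_n(\mathbf{b},\mathbf{a})=\sum_{\pi\in\mathrm{Sch}^{\le k}_{2n}}\mathrm{wt}(\pi;\mathbf{b},\mathbf{a})$ for $n\ge0$. If $(f_n)_{n\ge0}$ satisfies $f_n=c_1f_{n-1}+\cdots+c_df_{n-d}$ for all $n\ge d$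 with $c_d\ne0$, it is extended uniquely to all $n\in\mathbb{Z}$ so that the recurrence holds for all $n$; $\sigma^{\le k}_{ -n}(\mathbf{b},\mathbf{a})$ ($n\ge1$) denotes this extension (it exists when all $b_i\ne0$). -}

module Defs where

open import Level using (Level; _⊔_) renaming (suc to lsuc)
open import Algebra.Bundles using (CommutativeRing)
open import Data.Nat as ℕ using (ℕ; zero; suc; _<_; _<?_)
open import Data.Integer as ℤ using (ℤ; +_)
open import Data.List using (List; []; _∷_; _++_; map; foldr)
open import Data.Product using (Σ; _×_; ∃)
open import Relation.Nullary using (¬_; yes; no)

record Field (c ℓ : Level) : Set (lsuc (c ⊔ ℓ)) where
  field
    commutativeRing : CommutativeRing c ℓ
  open CommutativeRing commutativeRing public
  field
    0≉1   : ¬ (0# ≈ 1#)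
    inv   : (x : Carrier) → ¬ (x ≈ 0#) → Carrier
    inv-r : ∀ x (p : ¬ (x ≈ 0#)) → x * inv x p ≈ 1#

-- Sch k h N : Schröder paths starting at height h, of horizontal length N,
-- ending at height 0, staying weakly between y = 0 and y = k.
-- Constructors give the first step of the path.
data Sch (k : ℕ) : ℕ → ℕ → Set where
  end  : Sch k 0 0
  up   : ∀ {h N} → suc h ℕ.≤ k → Sch k (suc h) N → Sch k h (suc N)
  hor  : ∀ {h N} → Sch k h N → Sch k h (suc (suc N))
  down : ∀ {h N} → Sch k h N → Sch k (suc h) (suc N)

upPart : ∀ k h N → List (Sch k (suc h) N) → List (Sch k h (suc N))
upPart k h N ps with suc h ℕ.≤? k
... | yes p = map (up p) ps
... | no _  = []

allSch : ∀ k h N → List (Sch k h N)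
allSch k zero    zero = end ∷ []
allSch k (suc h) zero = []
allSch k zero    (suc zero)    = upPart k zero zero (allSch k 1 zero)
allSch k zero    (suc (suc M)) = upPart k zero (suc M) (allSch k 1 (suc M))
                                 ++ map hor (allSch k zero M)
allSch k (suc h) (suc zero)    = upPart k (suc h) zero (allSch k (suc (suc h)) zero)
                                 ++ map down (allSch k h zero)
allSch k (suc h) (suc (suc M)) = upPart k (suc h) (suc M) (allSch k (suc (suc h)) (suc M))
                                 ++ map down (allSch k h (suc M))
                                 ++ map hor (allSch k (suc h) M)

module _ {c ℓ} (F : Field c ℓ) where
  open Field F

  -- weight wt(π; b, a): product of b_i over (2,0) steps at height i and of
  -- a_i over (1,-1) steps starting at height i (i ≥ 1, so a 0 is never used).
  wt : (b a : ℕ → Carrier) → ∀ {k h N} → Sch k h N → Carrier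
  wt b a end = 1#
  wt b a (up _ p) = wt b a p
  wt b a (hor {h} p) = b h * wt b a p
  wt b a (down {h} p) = a (suc h) * wt b a p

  sumF : List Carrier → Carrier
  sumF = foldr _+_ 0#

  σ : (k : ℕ) (b a : ℕ → Carrier) (n : ℕ) → Carrier
  σ k b a n = sumF (map (wt b a) (allSch k 0 (n ℕ.* 2)))

  recSum : (cs : ℕ → Carrier) (f : ℤ → Carrier) (m : ℤ) (d : ℕ) → Carrier
  recSum cs f m zero = 0#
  recSum cs f m (suc d) = recSum cs f m d + cs (suc d) * f (m ℤ.- + suc d)

  IsRecExtension : (s : ℕ → Carrier) (f : ℤ → Carrier) → Set (c ⊔ ℓ)
  IsRecExtension s f =
    (∀ n → f (+ n) ≈ s n) ×
    Σ ℕ λ d → Σ (ℕ → Carrier) λ cs →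
      ¬ (cs (suc d) ≈ 0#) × (∀ m → f m ≈ recSum cs f m (suc d))

  -- b' = (b_i⁻¹), a' = (a_i b_{i-1}⁻¹ b_i⁻¹)_{i≥1} (a' 0 is unused; set to 0#)
  b′ : (b : ℕ → Carrier) → (∀ i → ¬ (b i ≈ 0#)) → ℕ → Carrier
  b′ b bnz i = inv (b i) (bnz i)

  a′ : (b : ℕ → Carrier) → (∀ i → ¬ (b i ≈ 0#)) → (a : ℕ → Carrier) → ℕ → Carrier
  a′ b bnz a zero = 0#
  a′ b bnz a (suc i) = a (suc i) * b′ b bnz i * b′ b bnz (suc i)

-- Arrange path sums in an array X(t, h), t ∈ ℤ, 0 ≤ h ≤ k.  For t ≥ 0, X(t, h) is the
-- weighted sum of Schröder paths from height h down to 0 of length h + 2t; splitting off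
-- the first step gives
--   X(t+1, h) = [h < k] X(t, h+1) + a_h X(t+1, h-1) + b_h X(t, h),
-- and since b_h ≠ 0 this recurrence determines the column X(t, ·) from X(t+1, ·),
-- while for large t the column h = 0 determines all the others.  For t = -1-s put
-- X(t, h) = b_0⁻¹ τ_h · (sum of (b′, a′)-weights of paths from height h of length 2s - h),
-- with τ_h = (-1)^h b_0 ⋯ b_{h-1}: multiplying the first-step decomposition for the primed
-- weights by b_h τ_h turns it into the recurrence above, read backwards in t.
-- Hence X satisfies the recurrence on all of ℤ.  By linearity, so does the array obtained
-- by applying the linear recurrence of f to X in the t variable; both arrays agree at
-- h = 0 for large t, hence everywhere, so X(·, 0) satisfies f's recurrence and equals f.
module Submission where

open import Defs
open import Data.Nat as ℕ using (ℕ; zero; suc; pred; _≤_; _<_; _∸_; z≤n)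
import Data.Nat.Properties as ℕ
open import Data.Integer as ℤ using (ℤ; +_; -[1+_]) renaming (-_ to ℤ-)
import Data.Integer.Properties as ℤ
open import Data.Integer.Tactic.RingSolver using (solve-∀)
open import Data.List using (List; []; _∷_; _++_; map)
open import Data.Product using (_,_; _×_; proj₂)
open import Data.Empty using (⊥; ⊥-elim)
open import Relation.Nullary using (¬_; yes; no)
open import Relation.Binary.PropositionalEquality as P using (_≡_)

+-suc-suc : ∀ m n → m ℕ.+ suc (suc n) ≡ suc (suc (m ℕ.+ n))
+-suc-suc m n = P.trans (ℕ.+-suc m (suc n)) (P.cong suc (ℕ.+-suc m n))

[1+t]-x≡1+[t-x] : ∀ t x → (ℤ.1ℤ ℤ.+ t) ℤ.- x ≡ ℤ.1ℤ ℤ.+ (t ℤ.- x)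
[1+t]-x≡1+[t-x] = solve-∀

t+[1+i]≡[1+t]+i : ∀ t i → t ℤ.+ (ℤ.1ℤ ℤ.+ i) ≡ (ℤ.1ℤ ℤ.+ t) ℤ.+ i
t+[1+i]≡[1+t]+i = solve-∀

t+x-x≡t : ∀ t x → (t ℤ.+ x) ℤ.- x ≡ t
t+x-x≡t = solve-∀

t+[2+j+e]-[1+j]≡[1+t]+e : ∀ t j e →
  (t ℤ.+ (ℤ.1ℤ ℤ.+ (ℤ.1ℤ ℤ.+ j ℤ.+ e))) ℤ.- (ℤ.1ℤ ℤ.+ j) ≡ (ℤ.1ℤ ℤ.+ t) ℤ.+ e
t+[2+j+e]-[1+j]≡[1+t]+e = solve-∀

ℤ-downwardInduction : ∀ {p} (Q : ℤ → Set p) (n₀ : ℕ) →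
  (∀ n → Q (+ (n₀ ℕ.+ n))) → (∀ t → Q (ℤ.suc t) → Q t) → ∀ t → Q t
ℤ-downwardInduction Q n₀ above step = go
  where
  descend : ∀ r n → Q (+ (r ℕ.+ n)) → Q (+ n)
  descend zero    n q = q
  descend (suc r) n q = descend r n (step (+ (r ℕ.+ n)) q)

  negative : ∀ n → Q -[1+ n ]
  negative zero    = step -[1+ 0 ] (descend n₀ 0 (above 0))
  negative (suc n) = step -[1+ suc n ] (negative n)

  go : ∀ t → Q t
  go (+ n)    = descend n₀ n (above n)
  go -[1+ n ] = negative n

module _ {c ℓ} (F : Field c ℓ) where
  open Field F
  open import Relation.Binary.Reasoning.Setoid setoid
  open import Algebra.Properties.Group +-group using (∙-cancelˡ; ∙-cancelʳ)
  open import Algebra.Properties.Ring ring using (-‿distribˡ-*; -‿distribʳ-*)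
  open import Algebra.Solver.Ring.NaturalCoefficients.Default commutativeSemiring

  *-cancelˡ-nonzero : ∀ x {y z} → ¬ (x ≈ 0#) → x * y ≈ x * z → y ≈ z
  *-cancelˡ-nonzero x {y} {z} x≉0 xy≈xz = begin
    y                ≈⟨ *-identityˡ y ⟨
    1# * y           ≈⟨ *-congʳ (sym xx⁻¹≈1) ⟩
    (x * x⁻¹) * y    ≈⟨ solve 3 (λ x x⁻¹ y → (x :* x⁻¹) :* y := x⁻¹ :* (x :* y)) refl x x⁻¹ y ⟩
    x⁻¹ * (x * y)    ≈⟨ *-congˡ xy≈xz ⟩
    x⁻¹ * (x * z)    ≈⟨ solve 3 (λ x x⁻¹ z → x⁻¹ :* (x :* z) := (x :* x⁻¹) :* z) refl x x⁻¹ z ⟩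
    (x * x⁻¹) * z    ≈⟨ *-congʳ xx⁻¹≈1 ⟩
    1# * z           ≈⟨ *-identityˡ z ⟩
    z                ∎
    where
    x⁻¹ : Carrier
    x⁻¹ = inv x x≉0
    xx⁻¹≈1 : x * x⁻¹ ≈ 1#
    xx⁻¹≈1 = inv-r x x≉0

  recSum-cong : ∀ cs {f g : ℤ → Carrier} m e →
    (∀ j → j < e → f (m ℤ.- + suc j) ≈ g (m ℤ.- + suc j)) →
    recSum F cs f m e ≈ recSum F cs g m e
  recSum-cong cs m zero    f≈g = refl
  recSum-cong cs m (suc e) f≈g =
    +-cong (recSum-cong cs m e (λ j j<e → f≈g j (ℕ.m<n⇒m<1+n j<e))) (*-congˡ (f≈g e (ℕ.n<1+n e)))

  recSum-shift : ∀ cs (f : ℤ → Carrier) m e →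
    recSum F cs (λ t → f (ℤ.suc t)) m e ≈ recSum F cs f (ℤ.suc m) e
  recSum-shift cs f m zero    = refl
  recSum-shift cs f m (suc e) =
    +-cong (recSum-shift cs f m e) (*-congˡ (reflexive (P.cong f (P.sym ([1+t]-x≡1+[t-x] m (+ suc e))))))

  -- Since c_{d+1} ≠ 0, the recurrence at t + d + 1 determines f t from f (t+1) … f (t+d+1).
  linearRecurrence-unique : ∀ {d cs} {f g : ℤ → Carrier} → ¬ (cs (suc d) ≈ 0#) →
    (∀ m → f m ≈ recSum F cs f m (suc d)) → (∀ m → g m ≈ recSum F cs g m (suc d)) →
    (∀ n → f (+ n) ≈ g (+ n)) → ∀ t → f t ≈ g t
  linearRecurrence-unique {d} {cs} {f} {g} cs≉0 f-rec g-rec f≈g t =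
    transport (ℤ.+-identityʳ t) (ℤ-downwardInduction AgreeFrom 0 (λ n i → f≈g (n ℕ.+ i)) extend t 0)
    where
    transport : ∀ {s t} → s ≡ t → f s ≈ g s → f t ≈ g t
    transport = P.subst (λ z → f z ≈ g z)

    AgreeFrom : ℤ → Set ℓ
    AgreeFrom t = ∀ i → f (t ℤ.+ + i) ≈ g (t ℤ.+ + i)

    agree-at : ∀ t → AgreeFrom (ℤ.suc t) → f t ≈ g t
    agree-at t hyp = transport (t+x-x≡t t (+ suc d)) (*-cancelˡ-nonzero (cs (suc d)) cs≉0 last)
      where
      m : ℤ
      m = t ℤ.+ + suc d
      earlier : recSum F cs f m d ≈ recSum F cs g m d
      earlier = recSum-cong cs m d λ j j<d →
        let (e , j+e≡d) = ℕ.m≤n⇒∃[o]m+o≡n j<d in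
        P.subst (λ d′ → f (t ℤ.+ + suc d′ ℤ.- + suc j) ≈ g (t ℤ.+ + suc d′ ℤ.- + suc j)) j+e≡d
          (transport (P.sym (t+[2+j+e]-[1+j]≡[1+t]+e t (+ j) (+ e))) (hyp e))
      last : cs (suc d) * f (m ℤ.- + suc d) ≈ cs (suc d) * g (m ℤ.- + suc d)
      last = ∙-cancelˡ (recSum F cs g m d) _ _ (begin
        recSum F cs g m d + cs (suc d) * f (m ℤ.- + suc d) ≈⟨ +-congʳ (sym earlier) ⟩
        recSum F cs f m (suc d)                             ≈⟨ sym (f-rec m) ⟩
        f m                                                 ≈⟨ transport (P.sym (t+[1+i]≡[1+t]+i t (+ d))) (hyp d) ⟩
        g m                                                 ≈⟨ g-rec m ⟩
        recSum F cs g m (suc d)                             ∎)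

    extend : ∀ t → AgreeFrom (ℤ.suc t) → AgreeFrom t
    extend t hyp zero    = transport (P.sym (ℤ.+-identityʳ t)) (agree-at t hyp)
    extend t hyp (suc i) = transport (P.sym (t+[1+i]≡[1+t]+i t (+ i))) (hyp i)

  module _ (k : ℕ) where

    Sch-height≤length : ∀ {h N} → Sch k h N → h ≤ N
    Sch-height≤length end        = z≤n
    Sch-height≤length (up _ p)   = ℕ.m≤n⇒m≤1+n (ℕ.<⇒≤ (Sch-height≤length p))
    Sch-height≤length (hor p)    = ℕ.m≤n⇒m≤1+n (ℕ.m≤n⇒m≤1+n (Sch-height≤length p))
    Sch-height≤length (down p)   = ℕ.s≤s (Sch-height≤length p)

    upCoeff : ℕ → Carrier
    upCoeff h with suc h ℕ.≤? k
    ... | yes _ = 1#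
    ... | no _  = 0#

    upCoeff-below : ∀ {h} → suc h ≤ k → ∀ x → upCoeff h * x ≈ x
    upCoeff-below {h} h<k x with suc h ℕ.≤? k
    ... | yes _   = *-identityˡ x
    ... | no h≮k = ⊥-elim (h≮k h<k)

    upCoeff-top : ∀ x → upCoeff k * x ≈ 0#
    upCoeff-top x with suc k ℕ.≤? k
    ... | yes k<k = ⊥-elim (ℕ.<-irrefl P.refl k<k)
    ... | no _    = zeroˡ x

    downTerm : (a Z : ℕ → Carrier) → ℕ → Carrier
    downTerm a Z zero    = 0#
    downTerm a Z (suc h) = a (suc h) * Z h

    -- A path sum from height h split by the first step: u, Z (h - 1) and w are the sums
    -- over the continuations after an up, a down and a horizontal step.
    firstStep : (b a : ℕ → Carrier) (h : ℕ) (u : Carrier) (Z : ℕ → Carrier) (w : Carrier) → Carrier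
    firstStep b a h u Z w = upCoeff h * u + (downTerm a Z h + b h * w)

    module _ (b a : ℕ → Carrier) where

      downTerm-+ : ∀ Z Z′ h → downTerm a (λ j → Z j + Z′ j) h ≈ downTerm a Z h + downTerm a Z′ h
      downTerm-+ Z Z′ zero    = sym (+-identityʳ 0#)
      downTerm-+ Z Z′ (suc h) = distribˡ _ _ _

      downTerm-* : ∀ x Z h → downTerm a (λ j → x * Z j) h ≈ x * downTerm a Z h
      downTerm-* x Z zero    = sym (zeroʳ x)
      downTerm-* x Z (suc h) = solve 3 (λ a x z → a :* (x :* z) := x :* (a :* z)) refl (a (suc h)) x (Z h)

      firstStep-zero : ∀ h → firstStep b a h 0# (λ _ → 0#) 0# ≈ 0#
      firstStep-zero h = begin
        upCoeff h * 0# + (downTerm a (λ _ → 0#) h + b h * 0#)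
          ≈⟨ +-cong (zeroʳ _) (+-cong (downTerm-zero h) (zeroʳ _)) ⟩
        0# + (0# + 0#)
          ≈⟨ trans (+-identityˡ _) (+-identityˡ 0#) ⟩
        0# ∎
        where
        downTerm-zero : ∀ h → downTerm a (λ _ → 0#) h ≈ 0#
        downTerm-zero zero    = refl
        downTerm-zero (suc h) = zeroʳ _

      firstStep-+ : ∀ h u u′ Z Z′ w w′ →
        firstStep b a h (u + u′) (λ j → Z j + Z′ j) (w + w′) ≈ firstStep b a h u Z w + firstStep b a h u′ Z′ w′
      firstStep-+ h u u′ Z Z′ w w′ = begin
        upCoeff h * (u + u′) + (downTerm a (λ j → Z j + Z′ j) h + b h * (w + w′))
          ≈⟨ +-congˡ (+-congʳ (downTerm-+ Z Z′ h)) ⟩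
        upCoeff h * (u + u′) + ((downTerm a Z h + downTerm a Z′ h) + b h * (w + w′))
          ≈⟨ solve 8 (λ α u u′ z z′ β w w′ → α :* (u :+ u′) :+ ((z :+ z′) :+ β :* (w :+ w′))
                        := (α :* u :+ (z :+ β :* w)) :+ (α :* u′ :+ (z′ :+ β :* w′)))
                     refl (upCoeff h) u u′ (downTerm a Z h) (downTerm a Z′ h) (b h) w w′ ⟩
        firstStep b a h u Z w + firstStep b a h u′ Z′ w′ ∎

      firstStep-* : ∀ x h u Z w → firstStep b a h (x * u) (λ j → x * Z j) (x * w) ≈ x * firstStep b a h u Z w
      firstStep-* x h u Z w = begin
        upCoeff h * (x * u) + (downTerm a (λ j → x * Z j) h + b h * (x * w))
          ≈⟨ +-congˡ (+-congʳ (downTerm-* x Z h)) ⟩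
        upCoeff h * (x * u) + (x * downTerm a Z h + b h * (x * w))
          ≈⟨ solve 6 (λ x α u z β w → α :* (x :* u) :+ (x :* z :+ β :* (x :* w))
                        := x :* (α :* u :+ (z :+ β :* w)))
                     refl x (upCoeff h) u (downTerm a Z h) (b h) w ⟩
        x * firstStep b a h u Z w ∎

      firstStep-down-only : ∀ h Z {u w} → u ≈ 0# → w ≈ 0# → firstStep b a h u Z w ≈ downTerm a Z h
      firstStep-down-only h Z {u} {w} u≈0 w≈0 = begin
        upCoeff h * u + (downTerm a Z h + b h * w)   ≈⟨ +-cong (*-congˡ u≈0) (+-congˡ (*-congˡ w≈0)) ⟩
        upCoeff h * 0# + (downTerm a Z h + b h * 0#) ≈⟨ solve 3 (λ α z β → α :* con 0 :+ (z :+ β :* con 0) := z)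
                                                              refl (upCoeff h) (downTerm a Z h) (b h) ⟩
        downTerm a Z h                               ∎

      firstStep-cancel-up : ∀ h {u u′ Z Z′ w w′} →
        firstStep b a h u Z w ≈ firstStep b a h u′ Z′ w′ →
        downTerm a Z h ≈ downTerm a Z′ h → b h * w ≈ b h * w′ → upCoeff h * u ≈ upCoeff h * u′
      firstStep-cancel-up h eq Z≈Z′ w≈w′ = ∙-cancelʳ _ _ _ (trans eq (+-congˡ (sym (+-cong Z≈Z′ w≈w′))))

      firstStep-cancel-hor : ∀ h {u u′ Z Z′ w w′} →
        firstStep b a h u Z w ≈ firstStep b a h u′ Z′ w′ →
        upCoeff h * u ≈ upCoeff h * u′ → downTerm a Z h ≈ downTerm a Z′ h → b h * w ≈ b h * w′
      firstStep-cancel-hor h eq u≈u′ Z≈Z′ =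
        ∙-cancelˡ _ _ _ (∙-cancelˡ _ _ _ (trans eq (+-cong (sym u≈u′) (+-congʳ (sym Z≈Z′)))))

      recSum-firstStep : ∀ cs h (U W : ℤ → Carrier) (Z : ℤ → ℕ → Carrier) m e →
        recSum F cs (λ t → firstStep b a h (U t) (Z t) (W t)) m e
          ≈ firstStep b a h (recSum F cs U m e) (λ j → recSum F cs (λ t → Z t j) m e) (recSum F cs W m e)
      recSum-firstStep cs h U W Z m zero    = sym (firstStep-zero h)
      recSum-firstStep cs h U W Z m (suc e) =
        trans (+-cong (recSum-firstStep cs h U W Z m e) (sym (firstStep-* (cs (suc e)) h (U s) (Z s) (W s))))
              (sym (firstStep-+ h _ _ _ _ _ _))
        where
        s : ℤ
        s = m ℤ.- + suc e

      weightSum : ∀ {h N} → List (Sch k h N) → Carrier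
      weightSum ps = sumF F (map (wt F b a) ps)

      pathSum : ℕ → ℕ → Carrier
      pathSum N h = weightSum (allSch k h N)

      weightSum-++ : ∀ {h N} (ps qs : List (Sch k h N)) → weightSum (ps ++ qs) ≈ weightSum ps + weightSum qs
      weightSum-++ [] qs       = sym (+-identityˡ _)
      weightSum-++ (p ∷ ps) qs = trans (+-congˡ (weightSum-++ ps qs)) (sym (+-assoc _ _ _))

      weightSum-map : ∀ {h N h′ N′} (s : Sch k h N → Sch k h′ N′) x →
        (∀ p → wt F b a (s p) ≈ x * wt F b a p) → ∀ ps → weightSum (map s ps) ≈ x * weightSum ps
      weightSum-map s x s-wt []       = sym (zeroʳ x)
      weightSum-map s x s-wt (p ∷ ps) =
        trans (+-cong (s-wt p) (weightSum-map s x s-wt ps)) (sym (distribˡ x _ _))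

      weightSum-upPart : ∀ h N ps → weightSum (upPart k h N ps) ≈ upCoeff h * weightSum ps
      weightSum-upPart h N ps with suc h ℕ.≤? k
      ... | yes h<k = weightSum-map (up h<k) 1# (λ p → sym (*-identityˡ _)) ps
      ... | no _    = sym (zeroˡ _)

      weightSum-hor : ∀ {h N} (ps : List (Sch k h N)) → weightSum (map hor ps) ≈ b h * weightSum ps
      weightSum-hor = weightSum-map hor _ (λ _ → refl)

      weightSum-down : ∀ {h N} (ps : List (Sch k h N)) → weightSum (map down ps) ≈ a (suc h) * weightSum ps
      weightSum-down = weightSum-map down _ (λ _ → refl)

      weightSum-empty : ∀ {h N} → (Sch k h N → ⊥) → ∀ ps → weightSum ps ≈ 0#
      weightSum-empty no-path []      = refl
      weightSum-empty no-path (p ∷ _) = ⊥-elim (no-path p)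

      pathSum-short : ∀ {N h} → N < h → pathSum N h ≈ 0#
      pathSum-short {N} {h} N<h = weightSum-empty (λ p → ℕ.<⇒≱ N<h (Sch-height≤length p)) (allSch k h N)

      pathSum-firstStep-suc : ∀ N h →
        pathSum (suc N) (suc h)
          ≈ firstStep b a (suc h) (pathSum N (2 ℕ.+ h)) (λ j → pathSum N j) (pathSum (pred N) (suc h))
      pathSum-firstStep-suc zero h = begin
        weightSum (ups ++ map down (allSch k h 0))
          ≈⟨ weightSum-++ ups _ ⟩
        weightSum ups + weightSum (map down (allSch k h 0))
          ≈⟨ +-cong (weightSum-upPart (suc h) 0 (allSch k (2 ℕ.+ h) 0)) (weightSum-down (allSch k h 0)) ⟩
        upCoeff (suc h) * pathSum 0 (2 ℕ.+ h) + a (suc h) * pathSum 0 h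
          ≈⟨ +-congˡ (sym (trans (+-congˡ (zeroʳ (b (suc h)))) (+-identityʳ _))) ⟩
        firstStep b a (suc h) (pathSum 0 (2 ℕ.+ h)) (λ j → pathSum 0 j) 0# ∎
        where
        ups : List (Sch k (suc h) 1)
        ups = upPart k (suc h) 0 (allSch k (2 ℕ.+ h) 0)
      pathSum-firstStep-suc (suc N) h =
        trans (weightSum-++ ups (map down (allSch k h (suc N)) ++ map hor (allSch k (suc h) N)))
              (+-cong (weightSum-upPart (suc h) (suc N) (allSch k (2 ℕ.+ h) (suc N)))
                      (trans (weightSum-++ (map down (allSch k h (suc N))) (map hor (allSch k (suc h) N)))
                             (+-cong (weightSum-down (allSch k h (suc N))) (weightSum-hor (allSch k (suc h) N)))))
        where
        ups : List (Sch k (suc h) (2 ℕ.+ N))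
        ups = upPart k (suc h) (suc N) (allSch k (2 ℕ.+ h) (suc N))

      pathSum-firstStep : ∀ N h →
        pathSum (2 ℕ.+ N) h
          ≈ firstStep b a h (pathSum (suc N) (suc h)) (λ j → pathSum (suc N) j) (pathSum N h)
      pathSum-firstStep N zero =
        trans (weightSum-++ (upPart k 0 (suc N) (allSch k 1 (suc N))) (map hor (allSch k 0 N)))
              (+-cong (weightSum-upPart 0 (suc N) (allSch k 1 (suc N)))
                      (trans (weightSum-hor (allSch k 0 N)) (sym (+-identityˡ _))))
      pathSum-firstStep N (suc h) = pathSum-firstStep-suc (suc N) h

      pathSum-diagonal : ∀ h → pathSum (suc h) (suc h) ≈ a (suc h) * pathSum h h
      pathSum-diagonal h =
        trans (pathSum-firstStep-suc h h)
              (firstStep-down-only (suc h) (λ j → pathSum h j) (pathSum-short (ℕ.m<n⇒m<1+n (ℕ.n<1+n h)))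
                                           (pathSum-short (ℕ.≤-<-trans (ℕ.pred[n]≤n {h}) (ℕ.n<1+n h))))

      -- The lengths x ∸ h index the columns of the array at negative times; when h > x all
      -- the sums involved vanish, so the truncated subtraction is harmless.
      pathSum-∸-firstStep : ∀ x h →
        pathSum (2 ℕ.+ x ∸ h) h
          ≈ firstStep b a h (pathSum (suc x ∸ h) (suc h)) (λ j → pathSum (x ∸ j) j) (pathSum (x ∸ h) h)
      pathSum-∸-firstStep x zero = pathSum-firstStep x 0
      pathSum-∸-firstStep x (suc h) with h ℕ.≤? x
      ... | yes h≤x rewrite ℕ.+-∸-assoc 1 h≤x | P.sym (ℕ.pred[m∸n]≡m∸[1+n] x h) =
        pathSum-firstStep-suc (x ∸ h) h
      ... | no h≰x = begin
        pathSum (suc x ∸ h) (suc h)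
          ≈⟨ pathSum-short (short h (ℕ.s<s x<h)) ⟩
        0#
          ≈⟨ trans (*-congˡ (pathSum-short (short h x<h))) (zeroʳ _) ⟨
        a (suc h) * pathSum (x ∸ h) h
          ≈⟨ firstStep-down-only (suc h) (λ j → pathSum (x ∸ j) j)
                                 (pathSum-short (short h (ℕ.m<n⇒m<1+n (ℕ.m<n⇒m<1+n x<h))))
                                 (pathSum-short (short (suc h) (ℕ.m<n⇒m<1+n x<h))) ⟨
        firstStep b a (suc h) (pathSum (x ∸ h) (2 ℕ.+ h)) (λ j → pathSum (x ∸ j) j) (pathSum (x ∸ suc h) (suc h)) ∎
        where
        x<h : x < h
        x<h = ℕ.≰⇒> h≰x
        short : ∀ {m o} n → m < o → m ∸ n < o
        short {m} n = ℕ.≤-<-trans (ℕ.m∸n≤m m n)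

    TransferSolution : (b a : ℕ → Carrier) → (ℤ → ℕ → Carrier) → Set ℓ
    TransferSolution b a X = ∀ t h → X (ℤ.suc t) h ≈ firstStep b a h (X t (suc h)) (X (ℤ.suc t)) (X t h)

    recSum-solution : ∀ {b a X} cs e → TransferSolution b a X →
      TransferSolution b a (λ t h → recSum F cs (λ m → X m h) t e)
    recSum-solution {b} {a} {X} cs e X-sol t h = begin
      recSum F cs (λ m → X m h) (ℤ.suc t) e
        ≈⟨ sym (recSum-shift cs (λ m → X m h) t e) ⟩
      recSum F cs (λ m → X (ℤ.suc m) h) t e
        ≈⟨ recSum-cong cs t e (λ j _ → X-sol _ h) ⟩
      recSum F cs (λ m → firstStep b a h (X m (suc h)) (X (ℤ.suc m)) (X m h)) t e
        ≈⟨ recSum-firstStep b a cs h (λ m → X m (suc h)) (λ m → X m h) (λ m → X (ℤ.suc m)) t e ⟩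
      firstStep b a h (recSum F cs (λ m → X m (suc h)) t e) (λ j → recSum F cs (λ m → X (ℤ.suc m) j) t e)
                      (recSum F cs (λ m → X m h) t e)
        ≈⟨ +-congˡ (+-congʳ (downTerm-shift h)) ⟩
      firstStep b a h (recSum F cs (λ m → X m (suc h)) t e) (λ j → recSum F cs (λ m → X m j) (ℤ.suc t) e)
                      (recSum F cs (λ m → X m h) t e) ∎
      where
      downTerm-shift : ∀ h → downTerm a (λ j → recSum F cs (λ m → X (ℤ.suc m) j) t e) h
                           ≈ downTerm a (λ j → recSum F cs (λ m → X m j) (ℤ.suc t) e) h
      downTerm-shift zero    = refl
      downTerm-shift (suc h) = *-congˡ (recSum-shift cs (λ m → X m h) t e)

    module _ {b a : ℕ → Carrier} (b≉0 : ∀ i → ¬ (b i ≈ 0#)) {X Y : ℤ → ℕ → Carrier}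
             (X-sol : TransferSolution b a X) (Y-sol : TransferSolution b a Y) where

      AgreeAbove : ℕ → ℕ → Set ℓ
      AgreeAbove n₀ h = ∀ n → n₀ ℕ.+ h ≤ n → X (+ n) h ≈ Y (+ n) h

      m+[1+n]≤o⇒m+n≤o : ∀ {m n o} → m ℕ.+ suc n ≤ o → m ℕ.+ n ≤ o
      m+[1+n]≤o⇒m+n≤o {m} {n} = ℕ.≤-trans (ℕ.+-monoʳ-≤ m (ℕ.n≤1+n n))

      agreeAbove-suc : ∀ {n₀} h → suc h ≤ k → AgreeAbove n₀ h →
        (∀ n → n₀ ℕ.+ h ≤ n → downTerm a (X (+ suc n)) h ≈ downTerm a (Y (+ suc n)) h) →
        AgreeAbove n₀ (suc h)
      agreeAbove-suc {n₀} h h<k agree agree-down n le = begin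
        X (+ n) (suc h)                   ≈⟨ upCoeff-below h<k _ ⟨
        upCoeff h * X (+ n) (suc h)       ≈⟨ firstStep-cancel-up b a h same-sum (agree-down n le′) (*-congˡ (agree n le′)) ⟩
        upCoeff h * Y (+ n) (suc h)       ≈⟨ upCoeff-below h<k _ ⟩
        Y (+ n) (suc h)                   ∎
        where
        le′ : n₀ ℕ.+ h ≤ n
        le′ = m+[1+n]≤o⇒m+n≤o le
        same-sum : firstStep b a h (X (+ n) (suc h)) (X (+ suc n)) (X (+ n) h)
                 ≈ firstStep b a h (Y (+ n) (suc h)) (Y (+ suc n)) (Y (+ n) h)
        same-sum = trans (sym (X-sol (+ n) h)) (trans (agree (suc n) (ℕ.m≤n⇒m≤1+n le′)) (Y-sol (+ n) h))

      agreeAbove-pair : ∀ {n₀} → AgreeAbove n₀ 0 → ∀ h → suc h ≤ k →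
        AgreeAbove n₀ h × AgreeAbove n₀ (suc h)
      agreeAbove-pair agree₀ zero    h<k = agree₀ , agreeAbove-suc 0 h<k agree₀ (λ _ _ → refl)
      agreeAbove-pair agree₀ (suc h) h<k =
        let (agree , agree-suc) = agreeAbove-pair agree₀ h (ℕ.<⇒≤ h<k) in
        agree-suc , agreeAbove-suc (suc h) h<k agree-suc
                      (λ n le → *-congˡ (agree (suc n) (ℕ.m≤n⇒m≤1+n (m+[1+n]≤o⇒m+n≤o le))))

      agreeAbove : ∀ {n₀} → AgreeAbove n₀ 0 → ∀ h → h ≤ k → AgreeAbove n₀ h
      agreeAbove agree₀ zero    _   = agree₀
      agreeAbove agree₀ (suc h) h≤k = proj₂ (agreeAbove-pair agree₀ h h≤k)

      -- The column at t is recovered from the one at t + 1 from the top height k down.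
      agreeBelow : ∀ t → (∀ h → h ≤ k → X (ℤ.suc t) h ≈ Y (ℤ.suc t) h) →
                         ∀ h → h ≤ k → X t h ≈ Y t h
      agreeBelow t agree h h≤k = fromTop (k ∸ h) h (ℕ.m∸n+n≡m h≤k)
        where
        downAgree : ∀ h → h ≤ k → downTerm a (X (ℤ.suc t)) h ≈ downTerm a (Y (ℤ.suc t)) h
        downAgree zero    _   = refl
        downAgree (suc h) h≤k = *-congˡ (agree h (ℕ.≤-trans (ℕ.n≤1+n h) h≤k))

        settle : ∀ h → h ≤ k → upCoeff h * X t (suc h) ≈ upCoeff h * Y t (suc h) → X t h ≈ Y t h
        settle h h≤k up-agree = *-cancelˡ-nonzero (b h) (b≉0 h)
          (firstStep-cancel-hor b a h (trans (sym (X-sol t h)) (trans (agree h h≤k) (Y-sol t h))) up-agree (downAgree h h≤k))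

        fromTop : ∀ r h → r ℕ.+ h ≡ k → X t h ≈ Y t h
        fromTop zero    h P.refl = settle h ℕ.≤-refl (trans (upCoeff-top _) (sym (upCoeff-top _)))
        fromTop (suc r) h r+h≡k  = settle h (P.subst (h ≤_) r+h≡k (ℕ.m≤n+m h (suc r)))
          (*-congˡ (fromTop r (suc h) (P.trans (ℕ.+-suc r h) r+h≡k)))

      transferSolution-unique : ∀ n₀ → (∀ n → n₀ ≤ n → X (+ n) 0 ≈ Y (+ n) 0) →
                                ∀ t h → h ≤ k → X t h ≈ Y t h
      transferSolution-unique n₀ agree₀ =
        ℤ-downwardInduction (λ t → ∀ h → h ≤ k → X t h ≈ Y t h) (n₀ ℕ.+ k) large agreeBelow
        where
        large : ∀ n h → h ≤ k → X (+ (n₀ ℕ.+ k ℕ.+ n)) h ≈ Y (+ (n₀ ℕ.+ k ℕ.+ n)) h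
        large n h h≤k = agreeAbove (λ n le → agree₀ n (P.subst (_≤ n) (ℕ.+-identityʳ n₀) le)) h h≤k _
                          (ℕ.≤-trans (ℕ.+-monoʳ-≤ n₀ h≤k) (ℕ.m≤m+n _ n))

    module _ (b : ℕ → Carrier) (b≉0 : ∀ i → ¬ (b i ≈ 0#)) (a : ℕ → Carrier) where
      private
        bᵈ aᵈ : ℕ → Carrier
        bᵈ = b′ F b b≉0
        aᵈ = a′ F b b≉0 a
        b₀⁻¹ : Carrier
        b₀⁻¹ = inv (b 0) (b≉0 0)

      twist : ℕ → Carrier
      twist zero    = 1#
      twist (suc h) = - (b h * twist h)

      downTerm-twist : ∀ h V → downTerm a (λ j → twist j * V j) h + b h * (twist h * downTerm aᵈ V h) ≈ 0#
      downTerm-twist zero    V = solve 2 (λ β τ → con 0 :+ β :* (τ :* con 0) := con 0) refl (b 0) 1#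
      downTerm-twist (suc h) V = begin
        p + b (suc h) * (- (b h * twist h) * (a (suc h) * bᵈ h * bᵈ (suc h) * V h))
          ≈⟨ +-congˡ (trans (*-congˡ (sym (-‿distribˡ-* _ _))) (sym (-‿distribʳ-* _ _))) ⟩
        p + - (b (suc h) * (b h * twist h * (a (suc h) * bᵈ h * bᵈ (suc h) * V h)))
          ≈⟨ +-congˡ (-‿cong (solve 7 (λ β β′ γ γ′ τ α v → β :* (γ :* τ :* (α :* γ′ :* β′ :* v))
                                                       := (α :* (τ :* v)) :* ((β :* β′) :* (γ :* γ′)))
                                    refl (b (suc h)) (bᵈ (suc h)) (b h) (bᵈ h) (twist h) (a (suc h)) (V h))) ⟩
        p + - (p * ((b (suc h) * bᵈ (suc h)) * (b h * bᵈ h)))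
          ≈⟨ +-congˡ (-‿cong (*-congˡ (*-cong (inv-r _ _) (inv-r _ _)))) ⟩
        p + - (p * (1# * 1#))
          ≈⟨ +-congˡ (-‿cong (solve 1 (λ p → p :* (con 1 :* con 1) := p) refl p)) ⟩
        p + - p
          ≈⟨ -‿inverseʳ p ⟩
        0# ∎
        where
        p : Carrier
        p = a (suc h) * (twist h * V h)

      -- Multiplying the primed first-step decomposition at height h by b_h τ_h.
      firstStep-dual : ∀ h u V w y → y ≈ firstStep bᵈ aᵈ h u V w →
        twist h * w ≈ firstStep b a h (twist (suc h) * u) (λ j → twist j * V j) (twist h * y)
      firstStep-dual h u V w y y≈ = sym (begin
        upCoeff h * (twist (suc h) * u) + (dn + b h * (twist h * y))
          ≈⟨ +-congˡ (+-congˡ (*-congˡ (*-congˡ y≈))) ⟩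
        upCoeff h * (twist (suc h) * u) + (dn + b h * (twist h * (upCoeff h * u + (dn′ + bᵈ h * w))))
          ≈⟨ solve 9 (λ α ν dn β τ u dn′ β′ w →
                        α :* (ν :* u) :+ (dn :+ β :* (τ :* (α :* u :+ (dn′ :+ β′ :* w))))
                        := α :* ((ν :+ β :* τ) :* u) :+ ((dn :+ β :* (τ :* dn′)) :+ (β :* β′) :* (τ :* w)))
                     refl (upCoeff h) (twist (suc h)) dn (b h) (twist h) u dn′ (bᵈ h) w ⟩
        upCoeff h * ((twist (suc h) + b h * twist h) * u) + ((dn + b h * (twist h * dn′)) + (b h * bᵈ h) * (twist h * w))
          ≈⟨ +-cong (*-congˡ (*-congʳ (-‿inverseˡ _))) (+-cong (downTerm-twist h V) (*-congʳ (inv-r _ _))) ⟩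
        upCoeff h * (0# * u) + (0# + 1# * (twist h * w))
          ≈⟨ solve 3 (λ α u x → α :* (con 0 :* u) :+ (con 0 :+ con 1 :* x) := x) refl (upCoeff h) u (twist h * w) ⟩
        twist h * w ∎)
        where
        dn dn′ : Carrier
        dn = downTerm a (λ j → twist j * V j) h
        dn′ = downTerm aᵈ V h

      pathArray : ℤ → ℕ → Carrier
      pathArray (+ t)    h = pathSum b a (h ℕ.+ t ℕ.* 2) h
      pathArray -[1+ s ] h = b₀⁻¹ * (twist h * pathSum bᵈ aᵈ (s ℕ.* 2 ∸ h) h)

      pathArray-boundary : ∀ h →
        pathArray (+ 0) h ≈ firstStep b a h (pathArray -[1+ 0 ] (suc h)) (pathArray (+ 0)) (pathArray -[1+ 0 ] h)
      pathArray-boundary zero = sym (begin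
        upCoeff 0 * (b₀⁻¹ * (twist 1 * 0#)) + (0# + b 0 * (b₀⁻¹ * (1# * (1# + 0#))))
          ≈⟨ solve 5 (λ α β β′ τ x → α :* (β′ :* (τ :* con 0)) :+ (con 0 :+ β :* (β′ :* (con 1 :* x)))
                                   := (β :* β′) :* x)
                   refl (upCoeff 0) (b 0) b₀⁻¹ (twist 1) (1# + 0#) ⟩
        (b 0 * b₀⁻¹) * (1# + 0#) ≈⟨ *-congʳ (inv-r _ _) ⟩
        1# * (1# + 0#)           ≈⟨ *-identityˡ _ ⟩
        1# + 0#                  ∎)
      pathArray-boundary (suc h) = begin
        pathSum b a (suc h ℕ.+ 0) (suc h)      ≡⟨ P.cong (λ N → pathSum b a N (suc h)) (ℕ.+-identityʳ (suc h)) ⟩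
        pathSum b a (suc h) (suc h)            ≈⟨ pathSum-diagonal b a h ⟩
        a (suc h) * pathSum b a h h            ≡⟨ P.cong (λ N → a (suc h) * pathSum b a N h) (ℕ.+-identityʳ h) ⟨
        downTerm a (pathArray (+ 0)) (suc h)   ≈⟨ firstStep-down-only b a (suc h) (pathArray (+ 0)) vanish vanish ⟨
        firstStep b a (suc h) (pathArray -[1+ 0 ] (2 ℕ.+ h)) (pathArray (+ 0)) (pathArray -[1+ 0 ] (suc h)) ∎
        where
        vanish : ∀ {x} → b₀⁻¹ * (x * 0#) ≈ 0#
        vanish = trans (*-congˡ (zeroʳ _)) (zeroʳ _)

      pathArray-solution : TransferSolution b a pathArray
      pathArray-solution (+ n) zero = pathSum-firstStep b a (n ℕ.* 2) 0
      pathArray-solution (+ n) (suc h) rewrite +-suc-suc h (n ℕ.* 2) =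
        pathSum-firstStep b a (suc (h ℕ.+ n ℕ.* 2)) (suc h)
      pathArray-solution -[1+ 0 ] h = pathArray-boundary h
      pathArray-solution -[1+ suc s ] h =
        trans (*-congˡ (firstStep-dual h _ _ _ _ (pathSum-∸-firstStep bᵈ aᵈ (s ℕ.* 2) h)))
              (sym (firstStep-* b a b₀⁻¹ h _ _ _))

      recExtension≈pathArray : ∀ {f} → IsRecExtension F (σ F k b a) f → ∀ t → f t ≈ pathArray t 0
      recExtension≈pathArray {f} (f≈σ , d , cs , cs≉0 , f-rec) =
        linearRecurrence-unique cs≉0 f-rec pathArray-rec f≈σ
        where
        f≈pathArray : ∀ n j → j < n → f (+ n ℤ.- + suc j) ≈ pathArray (+ n ℤ.- + suc j) 0
        f≈pathArray n j j<n rewrite ℤ.m-n≡m⊖n n (suc j) | ℤ.⊖-≥ j<n = f≈σ (n ∸ suc j)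

        large-times : ∀ n → suc d ≤ n → pathArray (+ n) 0 ≈ recSum F cs (λ m → pathArray m 0) (+ n) (suc d)
        large-times n d<n = begin
          pathArray (+ n) 0                              ≈⟨ f≈σ n ⟨
          f (+ n)                                        ≈⟨ f-rec (+ n) ⟩
          recSum F cs f (+ n) (suc d)                    ≈⟨ recSum-cong cs (+ n) (suc d) (λ j j≤d →
                                                              f≈pathArray n j (ℕ.<-≤-trans j≤d d<n)) ⟩
          recSum F cs (λ m → pathArray m 0) (+ n) (suc d) ∎

        pathArray-rec : ∀ t → pathArray t 0 ≈ recSum F cs (λ m → pathArray m 0) t (suc d)
        pathArray-rec t = transferSolution-unique b≉0 pathArray-solution
          (recSum-solution cs (suc d) pathArray-solution) (suc d) large-times t 0 z≤n

theorem9p6 : ∀ {c ℓ} (F : Field c ℓ) → let open Field F in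
    (b : ℕ → Carrier) (bnz : ∀ i → ¬ (b i ≈ 0#)) (a : ℕ → Carrier) →
    (k : ℕ) → 1 ≤ k → (f : ℤ → Carrier) → IsRecExtension F (σ F k b a) f →
    (n : ℕ) → 1 ≤ n →
    f (ℤ- (+ n)) ≈ inv (b 0) (bnz 0) * σ F k (b′ F b bnz) (a′ F b bnz a) (n ∸ 1)
theorem9p6 F b bnz a k _ f ext (suc m) _ =
  trans (recExtension≈pathArray F k b bnz a ext -[1+ m ]) (*-congˡ (*-identityˡ _))
  where open Field F
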